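{- Let $k\ge 1$ and let $G$ be a graph on $n$ vertices such that the distance-$k$ graph $G_k$ is triangle-free (i.e. no three vertices of $G$ are pairwise at distance $k$). Then \[ e(G_k)\le \frac{n(n-k+1)}{4}. \]
   Context: For a graph $G$, the distance-$k$ graph $G_k$ has vertex set $V(G)$, and $\{x,y\}\in E(G_k)$ if and only if $d_G(x,y)=k$, where $d_G$ is the shortest-path distance (number of edges) in $G$. -}

module Defs where

open import Data.Nat using (ℕ; zero; suc; _<ᵇ_)
open import Data.Fin using (Fin; toℕ)
open import Data.Bool using (Bool; true; false; _∧_; _∨_; not)
open import Data.Bool.ListAction using (any)
open import Data.List using (List; allFin; filter; length; concatMap; map)
open import Data.Product using (_×_; _,_; proj₁; proj₂)
open import Relation.Binary.PropositionalEquality using (_≡_)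
open import Relation.Nullary.Decidable using (Dec)
open import Data.Bool.Properties using (T?)

record Graph (n : ℕ) : Set where
  field
    adj    : Fin n → Fin n → Bool
    sym    : ∀ x y → adj x y ≡ adj y x
    irrefl : ∀ x → adj x x ≡ false
open Graph public

reach : ∀ {n} → Graph n → ℕ → Fin n → Fin n → Bool
reach {n} G zero    x y = toℕ x Data.Nat.≡ᵇ toℕ y
reach {n} G (suc m) x y =
  reach G m x y ∨ any (λ z → reach G m x z ∧ adj G z y) (allFin n)

-- distK G k x y = true  iff  d_G(x,y) = k  (for k ≥ 1): a walk of length ≤ k
-- exists but none of length ≤ k-1, i.e. the shortest path has exactly k edges.
-- (Vertices in different components have infinite distance, never equal to k.)
distK : ∀ {n} → Graph n → ℕ → Fin n → Fin n → Bool
distK G zero    x y = reach G zero x y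
distK G (suc k) x y = reach G (suc k) x y ∧ not (reach G k x y)

eDist : ∀ {n} → Graph n → ℕ → ℕ
eDist {n} G k =
  length (filter (λ p → T? ((toℕ (proj₁ p) <ᵇ toℕ (proj₂ p)) ∧ distK G k (proj₁ p) (proj₂ p)))
    (concatMap (λ x → map (λ y → (x , y)) (allFin n)) (allFin n)))

DistTriangleFree : ∀ {n} → Graph n → ℕ → Set
DistTriangleFree {n} G k =
  ∀ (x y z : Fin n) → distK G k x y ≡ true → distK G k y z ≡ true →
    distK G k x z ≡ true → Data.Empty.⊥
  where import Data.Empty

-- For an edge xy of G_k, the G_k-neighbourhoods of x and of y and the k − 1 interior
-- vertices of a shortest x–y path are pairwise disjoint: a common neighbour would close a
-- triangle in G_k, and an interior vertex is closer than k to both x and y. Hence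
-- d(x) + d(y) ≤ n − k + 1 for the degrees d in G_k, and summing over the e edges gives
-- Σ d(v)² ≤ e (n − k + 1). By Cauchy–Schwarz, Σ d(v)² ≥ (Σ d(v))² / n = 4e² / n.
module Submission where

open import Defs hiding (sym; irrefl)

open import Data.Bool using (Bool; true; false; T; _∧_; not)
open import Data.Bool.Properties using (T?; ⇔→≡; T-∨; T-∧; T-≡; T-not-≡; ¬-not; ∧-zeroʳ; ∧-identityʳ)
open import Data.Empty using (⊥-elim)
open import Data.Fin using (Fin; toℕ)
open import Data.Fin.Properties using (toℕ-injective)
open import Data.List using (List; []; _∷_; _++_; length; map; filter; concatMap; allFin; upTo)
open import Data.List.Membership.Propositional using (_∈_; lose)
open import Data.List.Membership.Propositional.Properties using (∈-allFin; ∈-upTo⁻)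
open import Data.List.Properties using (length-tabulate; length-upTo)
import Data.List.Relation.Unary.All as All
open import Data.List.Relation.Unary.Any using (here; there; satisfied)
open import Data.List.Relation.Unary.Any.Properties using (any⁺; any⁻)
open import Data.List.Relation.Unary.Unique.Propositional using (Unique; []; _∷_)
open import Data.List.Relation.Unary.Unique.Propositional.Properties using (upTo⁺)
open import Data.Nat
open import Data.Nat.Properties
open import Data.Nat.Tactic.RingSolver using (solve-∀)
open import Data.Product using (_×_; _,_; proj₁; proj₂; ∃-syntax)
open import Data.Sum using (_⊎_; inj₁; inj₂)
open import Function using (_∘_; id; case_of_; Equivalence; mk⇔)
open import Relation.Binary using (tri<; tri≈; tri>)
open import Relation.Binary.PropositionalEquality
open import Relation.Nullary using (¬_)

∑ : {A : Set} → List A → (A → ℕ) → ℕ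
∑ []       f = 0
∑ (x ∷ xs) f = f x + ∑ xs f

syntax ∑ xs (λ x → e) = ∑[ x ∈ xs ] e

𝟙 : Bool → ℕ
𝟙 true  = 1
𝟙 false = 0

private variable
  A B : Set

∑-cong : ∀ xs {f g : A → ℕ} → (∀ x → f x ≡ g x) → ∑ xs f ≡ ∑ xs g
∑-cong []       f≗g = refl
∑-cong (x ∷ xs) f≗g = cong₂ _+_ (f≗g x) (∑-cong xs f≗g)

∑-mono-≤ : ∀ xs {f g : A → ℕ} → (∀ {x} → x ∈ xs → f x ≤ g x) → ∑ xs f ≤ ∑ xs g
∑-mono-≤ []       f≤g = z≤n
∑-mono-≤ (x ∷ xs) f≤g = +-mono-≤ (f≤g (here refl)) (∑-mono-≤ xs (f≤g ∘ there))

∑-distrib-+ : ∀ xs (f g : A → ℕ) → ∑[ x ∈ xs ] (f x + g x) ≡ ∑ xs f + ∑ xs g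
∑-distrib-+ []       f g = refl
∑-distrib-+ (x ∷ xs) f g = begin
  f x + g x + ∑[ x ∈ xs ] (f x + g x) ≡⟨ cong (f x + g x +_) (∑-distrib-+ xs f g) ⟩
  f x + g x + (∑ xs f + ∑ xs g)       ≡⟨ +-interchange (f x) (g x) (∑ xs f) (∑ xs g) ⟩
  f x + ∑ xs f + (g x + ∑ xs g)       ∎
  where
  open ≡-Reasoning
  +-interchange : ∀ a b c d → a + b + (c + d) ≡ a + c + (b + d)
  +-interchange = solve-∀

∑-*ˡ : ∀ xs (c : ℕ) (f : A → ℕ) → ∑[ x ∈ xs ] (c * f x) ≡ c * ∑ xs f
∑-*ˡ []       c f = sym (*-zeroʳ c)
∑-*ˡ (x ∷ xs) c f = trans (cong (c * f x +_) (∑-*ˡ xs c f)) (sym (*-distribˡ-+ c (f x) (∑ xs f)))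

∑-*ʳ : ∀ xs (f : A → ℕ) (c : ℕ) → ∑[ x ∈ xs ] (f x * c) ≡ ∑ xs f * c
∑-*ʳ xs f c = begin
  ∑[ x ∈ xs ] (f x * c) ≡⟨ ∑-cong xs (λ x → *-comm (f x) c) ⟩
  ∑[ x ∈ xs ] (c * f x) ≡⟨ ∑-*ˡ xs c f ⟩
  c * ∑ xs f            ≡⟨ *-comm c (∑ xs f) ⟩
  ∑ xs f * c            ∎
  where open ≡-Reasoning

∑-const : ∀ (xs : List A) (c : ℕ) → ∑[ x ∈ xs ] c ≡ length xs * c
∑-const []       c = refl
∑-const (x ∷ xs) c = cong (c +_) (∑-const xs c)

∑-1≡length : ∀ (xs : List A) → ∑[ x ∈ xs ] 1 ≡ length xs
∑-1≡length xs = trans (∑-const xs 1) (*-identityʳ (length xs))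

∑-++ : ∀ xs ys (f : A → ℕ) → ∑ (xs ++ ys) f ≡ ∑ xs f + ∑ ys f
∑-++ []       ys f = refl
∑-++ (x ∷ xs) ys f = trans (cong (f x +_) (∑-++ xs ys f)) (sym (+-assoc (f x) (∑ xs f) (∑ ys f)))

∈⇒≤∑ : ∀ {xs x} (f : A → ℕ) → x ∈ xs → f x ≤ ∑ xs f
∈⇒≤∑                 f (here refl)  = m≤m+n _ _
∈⇒≤∑ {xs = y ∷ xs}   f (there x∈xs) = ≤-trans (∈⇒≤∑ f x∈xs) (m≤n+m _ (f y))

length-filter≡∑𝟙 : ∀ (p : A → Bool) xs → length (filter (T? ∘ p) xs) ≡ ∑[ x ∈ xs ] 𝟙 (p x)
length-filter≡∑𝟙 p []       = refl
length-filter≡∑𝟙 p (x ∷ xs) with p x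
... | true  = cong suc (length-filter≡∑𝟙 p xs)
... | false = length-filter≡∑𝟙 p xs

∑𝟙≡0 : ∀ (p : A → Bool) xs → (∀ {x} → x ∈ xs → p x ≢ true) → ∑[ x ∈ xs ] 𝟙 (p x) ≡ 0
∑𝟙≡0 p []       ¬p = refl
∑𝟙≡0 p (x ∷ xs) ¬p with p x in px
... | false = ∑𝟙≡0 p xs (¬p ∘ there)
... | true  = ⊥-elim (¬p (here refl) px)

∑𝟙≤1 : ∀ (p : A → Bool) {xs} → Unique xs → (∀ {a b} → p a ≡ true → p b ≡ true → a ≡ b) →
       ∑[ x ∈ xs ] 𝟙 (p x) ≤ 1
∑𝟙≤1 p []                    p-functional = z≤n
∑𝟙≤1 p {x ∷ xs} (x∉xs ∷ uniq) p-functional with p x in px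
... | false = ∑𝟙≤1 p uniq p-functional
... | true  = ≤-reflexive (cong suc (∑𝟙≡0 p xs (λ y∈xs py → All.lookup x∉xs y∈xs (p-functional px py))))

∑-map : ∀ (g : B → A) ys (f : A → ℕ) → ∑ (map g ys) f ≡ ∑[ y ∈ ys ] f (g y)
∑-map g []       f = refl
∑-map g (y ∷ ys) f = cong (f (g y) +_) (∑-map g ys f)

∑-concatMap : ∀ (g : B → List A) ys (f : A → ℕ) →
            ∑ (concatMap g ys) f ≡ ∑[ y ∈ ys ] ∑ (g y) f
∑-concatMap g []       f = refl
∑-concatMap g (y ∷ ys) f = trans (∑-++ (g y) (concatMap g ys) f) (cong (∑ (g y) f +_) (∑-concatMap g ys f))

∑-comm : ∀ xs ys (f : A → B → ℕ) →
         ∑[ x ∈ xs ] ∑[ y ∈ ys ] f x y ≡ ∑[ y ∈ ys ] ∑[ x ∈ xs ] f x y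
∑-comm []       ys f = sym (trans (∑-const ys 0) (*-zeroʳ (length ys)))
∑-comm (x ∷ xs) ys f = trans (cong (∑ ys (f x) +_) (∑-comm xs ys f)) (sym (∑-distrib-+ ys (f x) _))

2*ab≤a²+b² : ∀ a b → 2 * (a * b) ≤ a * a + b * b
2*ab≤a²+b² a b with ≤-total a b
... | inj₁ a≤b with c , refl ← m≤n⇒∃[o]m+o≡n a≤b =
  subst (2 * (a * (a + c)) ≤_) (sym (square-gap a c)) (m≤m+n _ (c * c))
  where
  square-gap : ∀ a c → a * a + (a + c) * (a + c) ≡ 2 * (a * (a + c)) + c * c
  square-gap = solve-∀
... | inj₂ b≤a with c , refl ← m≤n⇒∃[o]m+o≡n b≤a =
  subst (2 * ((b + c) * b) ≤_) (sym (square-gap b c)) (m≤m+n _ (c * c))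
  where
  square-gap : ∀ b c → (b + c) * (b + c) + b * b ≡ 2 * ((b + c) * b) + c * c
  square-gap = solve-∀

2*∑≤len+∑² : ∀ xs (d : A → ℕ) (a : ℕ) →
             2 * (a * ∑ xs d) ≤ length xs * (a * a) + ∑[ x ∈ xs ] (d x * d x)
2*∑≤len+∑² xs d a = begin
  2 * (a * ∑ xs d)                                ≡⟨ cong (2 *_) (∑-*ˡ xs a d) ⟨
  2 * ∑[ x ∈ xs ] (a * d x)                       ≡⟨ ∑-*ˡ xs 2 (λ x → a * d x) ⟨
  ∑[ x ∈ xs ] (2 * (a * d x))                     ≤⟨ ∑-mono-≤ xs (λ {x} _ → 2*ab≤a²+b² a (d x)) ⟩
  ∑[ x ∈ xs ] (a * a + d x * d x)                 ≡⟨ ∑-distrib-+ xs (λ _ → a * a) (λ x → d x * d x) ⟩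
  ∑[ x ∈ xs ] (a * a) + ∑[ x ∈ xs ] (d x * d x)   ≡⟨ cong (_+ ∑[ x ∈ xs ] (d x * d x)) (∑-const xs (a * a)) ⟩
  length xs * (a * a) + ∑[ x ∈ xs ] (d x * d x)   ∎
  where open ≤-Reasoning

cauchy-schwarz : ∀ xs (d : A → ℕ) → ∑ xs d * ∑ xs d ≤ length xs * ∑[ x ∈ xs ] (d x * d x)
cauchy-schwarz []       d = z≤n
cauchy-schwarz (x ∷ xs) d = begin
  (a + S) * (a + S)                  ≡⟨ expand a S ⟩
  a * a + 2 * (a * S) + S * S        ≤⟨ +-mono-≤ (+-monoʳ-≤ (a * a) (2*∑≤len+∑² xs d a)) (cauchy-schwarz xs d) ⟩
  a * a + (L * (a * a) + Q) + L * Q  ≡⟨ collect a Q L ⟩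
  suc L * (a * a + Q)                ∎
  where
  open ≤-Reasoning
  a = d x
  S = ∑ xs d
  Q = ∑[ x ∈ xs ] (d x * d x)
  L = length xs
  expand : ∀ a S → (a + S) * (a + S) ≡ a * a + 2 * (a * S) + S * S
  expand = solve-∀
  collect : ∀ a Q L → a * a + (L * (a * a) + Q) + L * Q ≡ suc L * (a * a + Q)
  collect = solve-∀

m*m≤n*q⇒q+q≤m*c⇒2*m≤n*c : ∀ m n q c → m * m ≤ n * q → q + q ≤ m * c → 2 * m ≤ n * c
m*m≤n*q⇒q+q≤m*c⇒2*m≤n*c zero      n q c _     _     = z≤n
m*m≤n*q⇒q+q≤m*c⇒2*m≤n*c m@(suc _) n q c m²≤nq 2q≤mc = *-cancelˡ-≤ m (begin
  m * (2 * m)  ≡⟨ shuffle₁ m ⟩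
  2 * (m * m)  ≤⟨ *-monoʳ-≤ 2 m²≤nq ⟩
  2 * (n * q)  ≡⟨ shuffle₂ n q ⟩
  n * (q + q)  ≤⟨ *-monoʳ-≤ n 2q≤mc ⟩
  n * (m * c)  ≡⟨ shuffle₃ n m c ⟩
  m * (n * c)  ∎)
  where
  open ≤-Reasoning
  shuffle₁ : ∀ m → m * (2 * m) ≡ 2 * (m * m)
  shuffle₁ = solve-∀
  shuffle₂ : ∀ n q → 2 * (n * q) ≡ n * (q + q)
  shuffle₂ = solve-∀
  shuffle₃ : ∀ n m c → n * (m * c) ≡ m * (n * c)
  shuffle₃ = solve-∀

𝟙<ᵇ+𝟙>ᵇ : ∀ m n → m ≢ n → 𝟙 (m <ᵇ n) + 𝟙 (n <ᵇ m) ≡ 1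
𝟙<ᵇ+𝟙>ᵇ zero    zero    m≢n = ⊥-elim (m≢n refl)
𝟙<ᵇ+𝟙>ᵇ zero    (suc n) m≢n = refl
𝟙<ᵇ+𝟙>ᵇ (suc m) zero    m≢n = refl
𝟙<ᵇ+𝟙>ᵇ (suc m) (suc n) m≢n = 𝟙<ᵇ+𝟙>ᵇ m n (m≢n ∘ cong suc)

𝟙-split-<ᵇ : ∀ m n b → (b ≡ true → m ≢ n) → 𝟙 ((m <ᵇ n) ∧ b) + 𝟙 ((n <ᵇ m) ∧ b) ≡ 𝟙 b
𝟙-split-<ᵇ m n false _   rewrite ∧-zeroʳ (m <ᵇ n) | ∧-zeroʳ (n <ᵇ m) = refl
𝟙-split-<ᵇ m n true  m≢n rewrite ∧-identityʳ (m <ᵇ n) | ∧-identityʳ (n <ᵇ m) = 𝟙<ᵇ+𝟙>ᵇ m n (m≢n refl)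

degree : ∀ {n} → Graph n → Fin n → ℕ
degree {n} H x = ∑[ y ∈ allFin n ] 𝟙 (adj H x y)

-- Pairs are enumerated exactly as in eDist, so that eDist G (suc k) is, by definition,
-- edges (Distances.distanceGraph G k).
edges : ∀ {n} → Graph n → ℕ
edges {n} H =
  length (filter (λ p → T? ((toℕ (proj₁ p) <ᵇ toℕ (proj₂ p)) ∧ adj H (proj₁ p) (proj₂ p)))
    (concatMap (λ x → map (λ y → (x , y)) (allFin n)) (allFin n)))

module _ {n : ℕ} (H : Graph n) where

  private
    V = allFin n
    d = degree H

  adj⇒toℕ-≢ : ∀ {x y} → adj H x y ≡ true → toℕ x ≢ toℕ y
  adj⇒toℕ-≢ {x} xy eq with refl ← toℕ-injective eq = case trans (sym xy) (Graph.irrefl H x) of λ ()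

  ordered-adj : Fin n → Fin n → Bool
  ordered-adj x y = (toℕ x <ᵇ toℕ y) ∧ adj H x y

  edges≡∑∑ : edges H ≡ ∑[ x ∈ V ] ∑[ y ∈ V ] 𝟙 (ordered-adj x y)
  edges≡∑∑ = begin
    edges H                                          ≡⟨ length-filter≡∑𝟙 ordered-pair pairs ⟩
    ∑[ p ∈ pairs ] 𝟙 (ordered-pair p)                ≡⟨ ∑-concatMap row V (𝟙 ∘ ordered-pair) ⟩
    ∑[ x ∈ V ] ∑[ p ∈ row x ] 𝟙 (ordered-pair p)     ≡⟨ ∑-cong V (λ x → ∑-map (x ,_) V (𝟙 ∘ ordered-pair)) ⟩
    ∑[ x ∈ V ] ∑[ y ∈ V ] 𝟙 (ordered-adj x y)        ∎
    where
    open ≡-Reasoning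
    ordered-pair : Fin n × Fin n → Bool
    ordered-pair (x , y) = ordered-adj x y
    row : Fin n → List (Fin n × Fin n)
    row x = map (x ,_) V
    pairs = concatMap row V

  handshake : edges H + edges H ≡ ∑[ x ∈ V ] d x
  handshake = begin
    edges H + edges H
      ≡⟨ cong₂ _+_ edges≡∑∑ (trans edges≡∑∑ (∑-comm V V (λ x y → 𝟙 (ordered-adj x y)))) ⟩
    ∑[ x ∈ V ] ∑[ y ∈ V ] 𝟙 (ordered-adj x y) + ∑[ x ∈ V ] ∑[ y ∈ V ] 𝟙 (ordered-adj y x)
      ≡⟨ ∑-distrib-+ V _ _ ⟨
    ∑[ x ∈ V ] (∑[ y ∈ V ] 𝟙 (ordered-adj x y) + ∑[ y ∈ V ] 𝟙 (ordered-adj y x))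
      ≡⟨ ∑-cong V (λ x → sym (∑-distrib-+ V _ _)) ⟩
    ∑[ x ∈ V ] ∑[ y ∈ V ] (𝟙 (ordered-adj x y) + 𝟙 (ordered-adj y x))
      ≡⟨ ∑-cong V (λ x → ∑-cong V (λ y → split x y)) ⟩
    ∑[ x ∈ V ] d x
      ∎
    where
    open ≡-Reasoning
    split : ∀ x y → 𝟙 (ordered-adj x y) + 𝟙 (ordered-adj y x) ≡ 𝟙 (adj H x y)
    split x y rewrite Graph.sym H y x = 𝟙-split-<ᵇ (toℕ x) (toℕ y) (adj H x y) adj⇒toℕ-≢

  ∑-degree-sums-over-edges :
    ∑[ x ∈ V ] ∑[ y ∈ V ] (𝟙 (adj H x y) * (d x + d y)) ≡ ∑[ x ∈ V ] (d x * d x) + ∑[ x ∈ V ] (d x * d x)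
  ∑-degree-sums-over-edges = begin
    ∑[ x ∈ V ] ∑[ y ∈ V ] (𝟙 (adj H x y) * (d x + d y))
      ≡⟨ ∑-cong V (λ x → trans (∑-cong V (λ y → *-distribˡ-+ (𝟙 (adj H x y)) (d x) (d y))) (∑-distrib-+ V _ _)) ⟩
    ∑[ x ∈ V ] (∑[ y ∈ V ] (𝟙 (adj H x y) * d x) + ∑[ y ∈ V ] (𝟙 (adj H x y) * d y))
      ≡⟨ ∑-distrib-+ V _ _ ⟩
    ∑[ x ∈ V ] ∑[ y ∈ V ] (𝟙 (adj H x y) * d x) + ∑[ x ∈ V ] ∑[ y ∈ V ] (𝟙 (adj H x y) * d y)
      ≡⟨ cong₂ _+_ (∑-cong V (λ x → ∑-*ʳ V (λ y → 𝟙 (adj H x y)) (d x))) (∑-comm V V _) ⟩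
    ∑[ x ∈ V ] (d x * d x) + ∑[ y ∈ V ] ∑[ x ∈ V ] (𝟙 (adj H x y) * d y)
      ≡⟨ cong (∑[ x ∈ V ] (d x * d x) +_) (∑-cong V column) ⟩
    ∑[ x ∈ V ] (d x * d x) + ∑[ y ∈ V ] (d y * d y)
      ∎
    where
    open ≡-Reasoning
    column : ∀ y → ∑[ x ∈ V ] (𝟙 (adj H x y) * d y) ≡ d y * d y
    column y = trans (∑-*ʳ V (λ x → 𝟙 (adj H x y)) (d y))
                     (cong (_* d y) (∑-cong V (λ x → cong 𝟙 (Graph.sym H x y))))

  4*edges≤n*c : ∀ c → (∀ x y → adj H x y ≡ true → d x + d y ≤ c) → 4 * edges H ≤ n * c
  4*edges≤n*c c edge-bound = subst (_≤ n * c) four-edges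
    (m*m≤n*q⇒q+q≤m*c⇒2*m≤n*c D n Q c cauchy-schwarz-degrees ∑-squares≤)
    where
    D = ∑[ x ∈ V ] d x
    Q = ∑[ x ∈ V ] (d x * d x)
    four-edges : 2 * D ≡ 4 * edges H
    four-edges = trans (cong (2 *_) (sym handshake)) (2*[e+e]≡4*e (edges H))
      where
      2*[e+e]≡4*e : ∀ e → 2 * (e + e) ≡ 4 * e
      2*[e+e]≡4*e = solve-∀
    cauchy-schwarz-degrees : D * D ≤ n * Q
    cauchy-schwarz-degrees = subst (λ m → D * D ≤ m * Q) (length-tabulate {n = n} id) (cauchy-schwarz V d)
    weighted : ∀ x y → 𝟙 (adj H x y) * (d x + d y) ≤ 𝟙 (adj H x y) * c
    weighted x y with adj H x y in xy
    ... | false = z≤n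
    ... | true  = *-monoʳ-≤ 1 (edge-bound x y xy)
    ∑-squares≤ : Q + Q ≤ D * c
    ∑-squares≤ = begin
      Q + Q                                                 ≡⟨ ∑-degree-sums-over-edges ⟨
      ∑[ x ∈ V ] ∑[ y ∈ V ] (𝟙 (adj H x y) * (d x + d y))   ≤⟨ ∑-mono-≤ V (λ _ → ∑-mono-≤ V (λ _ → weighted _ _)) ⟩
      ∑[ x ∈ V ] ∑[ y ∈ V ] (𝟙 (adj H x y) * c)             ≡⟨ ∑-cong V (λ x → ∑-*ʳ V (λ y → 𝟙 (adj H x y)) c) ⟩
      ∑[ x ∈ V ] (d x * c)                                  ≡⟨ ∑-*ʳ V d c ⟩
      D * c                                                 ∎
      where open ≤-Reasoning

module Distances {n : ℕ} (G : Graph n) where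

  -- A record rather than T (reach G m x y), so that m, x and y can be inferred from a proof.
  record Reach (m : ℕ) (x y : Fin n) : Set where
    constructor reach✓
    field reached : T (reach G m x y)

  private variable
    i j k m : ℕ
    x y z : Fin n

  reach-zero⇒≡ : Reach 0 x y → x ≡ y
  reach-zero⇒≡ {x} {y} (reach✓ r) = toℕ-injective (≡ᵇ⇒≡ (toℕ x) (toℕ y) r)

  reach-zero-refl : ∀ x → Reach 0 x x
  reach-zero-refl x = reach✓ (≡⇒≡ᵇ (toℕ x) (toℕ x) refl)

  reach-suc : Reach m x y → Reach (suc m) x y
  reach-suc (reach✓ r) = reach✓ (Equivalence.from T-∨ (inj₁ r))

  reach-snoc : Reach m x z → T (adj G z y) → Reach (suc m) x y
  reach-snoc {z = z} (reach✓ r) zy =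
    reach✓ (Equivalence.from T-∨ (inj₂ (any⁺ _ (lose (∈-allFin z) (Equivalence.from T-∧ (r , zy))))))

  reach-unsnoc : Reach (suc m) x y → Reach m x y ⊎ ∃[ z ] Reach m x z × T (adj G z y)
  reach-unsnoc {m} {x} {y} (reach✓ r) with Equivalence.to (T-∨ {reach G m x y}) r
  ... | inj₁ xy = inj₁ (reach✓ xy)
  ... | inj₂ xzy with z , xz∧zy ← satisfied (any⁻ _ (allFin n) xzy) =
    inj₂ (z , reach✓ (proj₁ (Equivalence.to T-∧ xz∧zy)) , proj₂ (Equivalence.to T-∧ xz∧zy))

  reach-mono′ : m ≤′ k → Reach m x y → Reach k x y
  reach-mono′ ≤′-refl        r = r
  reach-mono′ (≤′-step m≤′k) r = reach-suc (reach-mono′ m≤′k r)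

  reach-mono : m ≤ k → Reach m x y → Reach k x y
  reach-mono = reach-mono′ ∘ ≤⇒≤′

  reach-refl : ∀ m x → Reach m x x
  reach-refl m x = reach-mono z≤n (reach-zero-refl x)

  reach-trans : ∀ i j → Reach i x y → Reach j y z → Reach (j + i) x z
  reach-trans i zero    xy yz with refl ← reach-zero⇒≡ yz = xy
  reach-trans i (suc j) xy yz with reach-unsnoc yz
  ... | inj₁ yz′             = reach-suc (reach-trans i j xy yz′)
  ... | inj₂ (w , yw , wz)   = reach-snoc (reach-trans i j xy yw) wz

  reach-split : ∀ i j → Reach (j + i) x z → ∃[ y ] Reach i x y × Reach j y z
  reach-split {z = z} i zero xz = z , xz , reach-zero-refl z
  reach-split i (suc j) xz with reach-unsnoc xz
  ... | inj₁ xz′ with y , xy , yz ← reach-split i j xz′ = y , xy , reach-suc yz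
  ... | inj₂ (w , xw , wz) with y , xy , yw ← reach-split i j xw = y , xy , reach-snoc yw wz

  reach-sym : Reach m x y → Reach m y x
  reach-sym {zero}  xy with refl ← reach-zero⇒≡ xy = xy
  reach-sym {suc m} {x} {y} xy with reach-unsnoc xy
  ... | inj₁ xy′           = reach-suc (reach-sym xy′)
  ... | inj₂ (z , xz , zy) = subst (λ l → Reach l y x) (+-comm m 1)
    (reach-trans 1 m (reach-snoc (reach-zero-refl y) (subst T (Graph.sym G z y) zy)) (reach-sym xz))

  reach-sym-≡ : ∀ m x y → reach G m x y ≡ reach G m y x
  reach-sym-≡ m x y = ⇔→≡ (mk⇔ (flip {x} {y}) (flip {y} {x}))
    where
    flip : ∀ {x y} → reach G m x y ≡ true → reach G m y x ≡ true
    flip {x} {y} xy = Equivalence.to T-≡ (Reach.reached (reach-sym (reach✓ {m} {x} {y} (Equivalence.from T-≡ xy))))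

  AtDistance : ℕ → Fin n → Fin n → Set
  AtDistance k x y = distK G k x y ≡ true

  distK-sym : ∀ k x y → distK G k x y ≡ distK G k y x
  distK-sym zero    x y = reach-sym-≡ 0 x y
  distK-sym (suc k) x y = cong₂ (λ a b → a ∧ not b) (reach-sym-≡ (suc k) x y) (reach-sym-≡ k x y)

  atDistance⇒reach : AtDistance (suc k) x y → Reach (suc k) x y
  atDistance⇒reach xy = reach✓ (proj₁ (Equivalence.to T-∧ (Equivalence.from T-≡ xy)))

  atDistance⇒¬reach : AtDistance (suc k) x y → ¬ Reach k x y
  atDistance⇒¬reach xy (reach✓ r) =
    subst T (Equivalence.to T-not-≡ (proj₂ (Equivalence.to T-∧ (Equivalence.from T-≡ xy)))) r

  reach⇒atDistance : Reach (suc k) x y → ¬ Reach k x y → AtDistance (suc k) x y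
  reach⇒atDistance (reach✓ r) ¬r = Equivalence.to T-≡ (Equivalence.from T-∧
    (r , Equivalence.from T-not-≡ (¬-not (¬r ∘ reach✓ ∘ Equivalence.from T-≡))))

  atDistance-irrefl : ∀ k x → distK G (suc k) x x ≡ false
  atDistance-irrefl k x = ¬-not (λ xx → atDistance⇒¬reach xx (reach-refl k x))

  atDistance-unique : AtDistance (suc i) x y → AtDistance (suc j) x y → i ≡ j
  atDistance-unique {i = i} {j = j} xy xy′ with <-cmp i j
  ... | tri< i<j _ _ = ⊥-elim (atDistance⇒¬reach xy′ (reach-mono i<j (atDistance⇒reach xy)))
  ... | tri≈ _ i≡j _ = i≡j
  ... | tri> _ _ j<i = ⊥-elim (atDistance⇒¬reach xy (reach-mono j<i (atDistance⇒reach xy′)))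

  atDistance-midpoint : j < k → AtDistance (suc k) x y → ∃[ v ] AtDistance (suc j) x v × Reach (k ∸ j) v y
  atDistance-midpoint {j} {k} {x} {y} j<k xy =
    let v , xv , vy = reach-split (suc j) (k ∸ j) (cast (sym k∸j+1+j≡1+k) (atDistance⇒reach xy))
        ¬xv = λ xv′ → atDistance⇒¬reach xy (cast k∸j+j≡k (reach-trans j (k ∸ j) xv′ vy))
    in v , reach⇒atDistance xv ¬xv , vy
    where
    cast : ∀ {l l′} → l ≡ l′ → Reach l x y → Reach l′ x y
    cast refl r = r
    k∸j+j≡k : k ∸ j + j ≡ k
    k∸j+j≡k = m∸n+n≡m (<⇒≤ j<k)
    k∸j+1+j≡1+k : k ∸ j + suc j ≡ suc k
    k∸j+1+j≡1+k = trans (+-suc (k ∸ j) j) (cong suc k∸j+j≡k)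

  distanceGraph : ℕ → Graph n
  distanceGraph k = record
    { adj    = distK G (suc k)
    ; sym    = distK-sym (suc k)
    ; irrefl = atDistance-irrefl k
    }

  module _ (k : ℕ) (triangle-free : DistTriangleFree G (suc k)) {x y : Fin n} (xy : AtDistance (suc k) x y) where

    private
      V = allFin n
      d = degree (distanceGraph k)

    -- interior j w: w lies on a shortest x–y path, at distance suc j from x.
    interior : ℕ → Fin n → Bool
    interior j w = distK G (suc j) x w ∧ reach G (k ∸ j) w y

    interior⇒ : ∀ j → interior j z ≡ true → AtDistance (suc j) x z × Reach (k ∸ j) z y
    interior⇒ j e = let xz , zy = Equivalence.to T-∧ (Equivalence.from T-≡ e) in Equivalence.to T-≡ xz , reach✓ zy

    ⇒interior : ∀ j → AtDistance (suc j) x z → Reach (k ∸ j) z y → interior j z ≡ true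
    ⇒interior j xz (reach✓ zy) = Equivalence.to T-≡ (Equivalence.from T-∧ (Equivalence.from T-≡ xz , zy))

    interior-¬x : ∀ j → j < k → interior j z ≡ true → ¬ AtDistance (suc k) x z
    interior-¬x j j<k e xz with refl ← atDistance-unique {i = j} {j = k} (proj₁ (interior⇒ j e)) xz = <-irrefl refl j<k

    interior-¬y : ∀ j → interior j z ≡ true → ¬ AtDistance (suc k) y z
    interior-¬y j e yz = atDistance⇒¬reach yz (reach-sym (reach-mono (m∸n≤m k j) (proj₂ (interior⇒ j e))))

    vertex-contribution≤1 : ∀ w → 𝟙 (distK G (suc k) x w) + 𝟙 (distK G (suc k) y w) + ∑[ j ∈ upTo k ] 𝟙 (interior j w) ≤ 1
    vertex-contribution≤1 w with distK G (suc k) x w in xw | distK G (suc k) y w in yw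
    ... | true  | true  = ⊥-elim (triangle-free x y w xy yw xw)
    ... | true  | false = ≤-reflexive (cong suc (∑𝟙≡0 (λ j → interior j w) (upTo k) (λ {j} j<k e → interior-¬x j (∈-upTo⁻ j<k) e xw)))
    ... | false | true  = ≤-reflexive (cong suc (∑𝟙≡0 (λ j → interior j w) (upTo k) (λ {j} _ e → interior-¬y j e yw)))
    ... | false | false = ∑𝟙≤1 (λ j → interior j w) (upTo⁺ k)
      (λ {i} {j} e e′ → atDistance-unique {i = i} {j = j} (proj₁ (interior⇒ i e)) (proj₁ (interior⇒ j e′)))

    interior-exists : ∀ j → j < k → 1 ≤ ∑[ w ∈ V ] 𝟙 (interior j w)
    interior-exists j j<k =
      let v , xv , vy = atDistance-midpoint j<k xy
      in ≤-trans (≤-reflexive (cong 𝟙 (sym (⇒interior j xv vy)))) (∈⇒≤∑ (λ w → 𝟙 (interior j w)) (∈-allFin v))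

    degree-sum+k≤n : d x + d y + k ≤ n
    degree-sum+k≤n = begin
      d x + d y + k                                            ≡⟨ cong (d x + d y +_) (trans (∑-1≡length (upTo k)) (length-upTo k)) ⟨
      d x + d y + ∑[ j ∈ upTo k ] 1                            ≤⟨ +-monoʳ-≤ (d x + d y) (∑-mono-≤ (upTo k) (λ j<k → interior-exists _ (∈-upTo⁻ j<k))) ⟩
      d x + d y + ∑[ j ∈ upTo k ] ∑[ w ∈ V ] 𝟙 (interior j w)  ≡⟨ cong (d x + d y +_) (∑-comm (upTo k) V _) ⟩
      d x + d y + ∑[ w ∈ V ] ∑[ j ∈ upTo k ] 𝟙 (interior j w)  ≡⟨ ∑-distrib-+₃ ⟨
      ∑[ w ∈ V ] (𝟙 (distK G (suc k) x w) + 𝟙 (distK G (suc k) y w) + ∑[ j ∈ upTo k ] 𝟙 (interior j w))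
                                                               ≤⟨ ∑-mono-≤ V (λ {w} _ → vertex-contribution≤1 w) ⟩
      ∑[ w ∈ V ] 1                                             ≡⟨ trans (∑-1≡length V) (length-tabulate id) ⟩
      n                                                        ∎
      where
      open ≤-Reasoning
      ∑-distrib-+₃ : ∑[ w ∈ V ] (𝟙 (distK G (suc k) x w) + 𝟙 (distK G (suc k) y w) + ∑[ j ∈ upTo k ] 𝟙 (interior j w))
                   ≡ d x + d y + ∑[ w ∈ V ] ∑[ j ∈ upTo k ] 𝟙 (interior j w)
      ∑-distrib-+₃ = trans (∑-distrib-+ V _ _) (cong (_+ ∑[ w ∈ V ] ∑[ j ∈ upTo k ] 𝟙 (interior j w)) (∑-distrib-+ V _ _))

    edge-degree-sum≤ : d x + d y ≤ (n + 1) ∸ suc k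
    edge-degree-sum≤ = subst (d x + d y ≤_) (cong (_∸ suc k) (+-comm 1 n)) (m+n≤o⇒m≤o∸n (d x + d y) degree-sum+k≤n)

lemma2p1 : (k n : ℕ) → 1 ≤ k → (G : Graph n) → DistTriangleFree G k →
    4 * eDist G k ≤ n * ((n + 1) ∸ k)
lemma2p1 (suc k) n _ G triangle-free =
  4*edges≤n*c (distanceGraph k) ((n + 1) ∸ suc k) (λ _ _ → edge-degree-sum≤ k triangle-free)
  where open Distances G
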